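{- Let $G$ be a graph of order $n$ having $t$ twin equivalence classes. Then $$\gamma_{\rm sp}(G)\ge n-t.$$ Furthermore, if $G$ is connected and $t\ge 3$, then $$\gamma_{\rm sp}(G)\ge n-t+1.$$
   Context: All graphs are finite, simple and undirected. For a vertex $v$ of a graph $G$, $N(v)$ denotes the set of vertices adjacent to $v$ and $N[v]=N(v)\cup\{v\}$. For $D\subseteq V(G)$ write $\overline{D}=V(G)\setminus D$. A set $D\subseteq V(G)$ is a super dominating set of $G$ if for every $u\in\overline{D}$ there exists $v\in D$ such that $N(v)\cap\overline{D}=\{u\}$; the super domination number $\gamma_{\rm sp}(G)$ is the minimum cardinality of a super dominating set of $G$. The twin equivalence relation on $V(G)$ is defined by $x\,\mathcal{R}\,y$ if and only if $N[x]=N[y]$ or $N(x)=N(y)$; its equivalence classes are called twin equivalence classes. -}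

module Defs where

open import Data.Nat using (ℕ; _≤_)
open import Data.Fin using (Fin; _≟_)
open import Data.Fin.Subset using (Subset; _∈_; _∉_; ∣_∣)
open import Data.Bool using (Bool; true; false; _∨_)
open import Data.Product using (Σ; ∃; _×_; _,_)
open import Data.Sum using (_⊎_)
open import Relation.Nullary using (¬_)
open import Relation.Nullary.Decidable using (⌊_⌋)
open import Relation.Binary.PropositionalEquality using (_≡_)
open import Function.Bundles using (_⇔_)
open import Function.Definitions using (Surjective)

record Graph (n : ℕ) : Set where
  field
    adj     : Fin n → Fin n → Bool
    sym     : ∀ x y → adj x y ≡ adj y x
    irrefl  : ∀ x → adj x x ≡ false

open Graph public

module _ {n : ℕ} (G : Graph n) where

  InN : Fin n → Fin n → Set
  InN x z = adj G x z ≡ true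

  InNc : Fin n → Fin n → Set
  InNc x z = (⌊ z ≟ x ⌋ ∨ adj G x z) ≡ true

  Twin : Fin n → Fin n → Set
  Twin x y = (∀ z → InNc x z ⇔ InNc y z) ⊎ (∀ z → InN x z ⇔ InN y z)

  -- G has exactly t twin equivalence classes: there is a surjective
  -- map onto Fin t whose fibres are exactly the twin classes.
  HasTwinClasses : ℕ → Set
  HasTwinClasses t =
    Σ (Fin n → Fin t) λ c →
      Surjective _≡_ _≡_ c × (∀ x y → (c x ≡ c y) ⇔ Twin x y)

  SuperDominating : Subset n → Set
  SuperDominating D =
    ∀ u → u ∉ D → ∃ λ v → v ∈ D × (∀ w → (InN v w × w ∉ D) ⇔ (w ≡ u))

  IsSuperDominationNumber : ℕ → Set
  IsSuperDominationNumber k =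
    (∃ λ D → SuperDominating D × ∣ D ∣ ≡ k) ×
    (∀ D → SuperDominating D → k ≤ ∣ D ∣)

  data Reachable (x : Fin n) : Fin n → Set where
    here : Reachable x x
    step : ∀ {y z} → Reachable x y → InN y z → Reachable x z

  Connected : Set
  Connected = ∀ x y → Reachable x y

-- Each twin class contains at most one vertex outside a super dominating set D:
-- if x, y ∉ D are twins and v ∈ D has x as its only neighbour outside D, then v
-- is also adjacent to y, so y = x. Hence n − |D| ≤ t.
--
-- If some twin class lies entirely inside D, the count improves by one.
-- Otherwise every class meets the complement of D; then, following private
-- neighbours twice, one finds vertices a, b outside D with N(a) ∖ D ⊆ {b} and
-- N(b) ∖ D ⊆ {a}, and the union of the classes of a and b is closed under
-- adjacency. For connected G it is all of V(G), contradicting t ≥ 3.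
module Submission where

open import Data.Nat using (ℕ; zero; suc; _≤_; _<_; _+_; _∸_; z≤n; s≤s; NonZero; >-nonZero)
open import Data.Nat.Properties
  using ( module ≤-Reasoning; ≤-<-trans; +-comm; +-monoʳ-≤; +-monoʳ-<; ≤⇒≯
        ; m≤n+m∸n; m≤n+o⇒m∸n≤o; m<n+o⇒m∸n<o )
open import Data.Fin using (Fin; zero; suc; punchOut; fromℕ<; _≟_)
open import Data.Fin.Properties using (suc-injective; punchOut-injective; all?; any?; ¬∀⟶∃¬)
open import Data.Fin.Subset using (Subset; _∈_; _∉_; ∁; ∣_∣)
open import Data.Fin.Subset.Properties
  using (_∈?_; x∈∁p⇒x∉p; ∣∁p∣≡n∸∣p∣; x∈p⇒∣p-x∣<∣p∣)
open import Data.Vec using (_∷_; []; here; there)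
open import Data.Bool using (true; false)
open import Data.Bool.Properties using (∨-zeroʳ)
open import Data.Empty using (⊥-elim)
open import Data.Product using (_×_; ∃; ∃₂; _,_; proj₁; proj₂)
open import Data.Sum using (_⊎_; inj₁; inj₂; swap)
open import Function.Base using (case_of_)
open import Function.Bundles using (Equivalence)
open import Function.Definitions using (Surjective)
open import Relation.Binary.PropositionalEquality
  using (_≡_; _≢_; refl; sym; trans; cong; subst)
open import Relation.Nullary using (¬_; Dec; yes; no; ¬?; contradiction)
open import Relation.Nullary.Decidable using (_×-dec_; decidable-stable)
open import Defs hiding (sym)

open Equivalence using (to; from)

m∸n≤o⇒m∸o≤n : ∀ m n o → m ∸ n ≤ o → m ∸ o ≤ n
m∸n≤o⇒m∸o≤n m n o m∸n≤o = m≤n+o⇒m∸n≤o m o (begin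
  m           ≤⟨ m≤n+m∸n m n ⟩
  n + (m ∸ n) ≤⟨ +-monoʳ-≤ n m∸n≤o ⟩
  n + o       ≡⟨ +-comm n o ⟩
  o + n       ∎)
  where open ≤-Reasoning

m∸n<o⇒m∸o<n : ∀ m n o → .{{NonZero n}} → m ∸ n < o → m ∸ o < n
m∸n<o⇒m∸o<n m n o m∸n<o = m<n+o⇒m∸n<o m o (begin-strict
  m           ≤⟨ m≤n+m∸n m n ⟩
  n + (m ∸ n) <⟨ +-monoʳ-< n m∸n<o ⟩
  n + o       ≡⟨ +-comm n o ⟩
  o + n       ∎)
  where open ≤-Reasoning

x∈p∧y∉p⇒x≢y : ∀ {n} {x y : Fin n} {p : Subset n} → x ∈ p → y ∉ p → x ≢ y
x∈p∧y∉p⇒x≢y x∈p y∉p refl = y∉p x∈p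

0<∣p∣ : ∀ {n} {x : Fin n} {p : Subset n} → x ∈ p → 0 < ∣ p ∣
0<∣p∣ x∈p = ≤-<-trans z≤n (x∈p⇒∣p-x∣<∣p∣ x∈p)

∈-injective⇒∣p∣≤ : ∀ {n m} (p : Subset n) (f : ∀ {x} → x ∈ p → Fin m) →
  (∀ {x y} (x∈p : x ∈ p) (y∈p : y ∈ p) → f x∈p ≡ f y∈p → x ≡ y) → ∣ p ∣ ≤ m
∈-injective⇒∣p∣≤ [] f inj = z≤n
∈-injective⇒∣p∣≤ (false ∷ p) f inj =
  ∈-injective⇒∣p∣≤ p (λ x∈p → f (there x∈p))
    (λ x∈p y∈p e → suc-injective (inj (there x∈p) (there y∈p) e))
∈-injective⇒∣p∣≤ {m = zero} (true ∷ p) f inj with f here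
... | ()
∈-injective⇒∣p∣≤ {m = suc m} (true ∷ p) f inj =
  s≤s (∈-injective⇒∣p∣≤ p (λ x∈p → punchOut (f-here≢ x∈p)) λ x∈p y∈p e →
    suc-injective (inj (there x∈p) (there y∈p) (punchOut-injective (f-here≢ x∈p) (f-here≢ y∈p) e)))
  where
  f-here≢ : ∀ {x} (x∈p : x ∈ p) → f here ≢ f (there x∈p)
  f-here≢ x∈p e with inj here (there x∈p) e
  ... | ()

covered-by-two⇒≤2 : ∀ {t} (i j : Fin t) → (∀ k → k ≡ i ⊎ k ≡ j) → t ≤ 2
covered-by-two⇒≤2 {zero} i j cover = z≤n
covered-by-two⇒≤2 {suc zero} i j cover = s≤s z≤n
covered-by-two⇒≤2 {suc (suc zero)} i j cover = s≤s (s≤s z≤n)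
covered-by-two⇒≤2 {suc (suc (suc t))} i j cover
  with cover zero | cover (suc zero) | cover (suc (suc zero))
... | inj₁ refl | inj₁ ()   | _
... | inj₁ refl | inj₂ refl | inj₁ ()
... | inj₁ refl | inj₂ refl | inj₂ ()
... | inj₂ refl | inj₁ refl | inj₁ ()
... | inj₂ refl | inj₁ refl | inj₂ ()
... | inj₂ refl | inj₂ ()   | _

some-class-inside-or-all-meet : ∀ {n t} (D : Subset n) (c : Fin n → Fin t) →
  (∃ λ j → ∀ x → c x ≡ j → x ∈ D) ⊎ (∀ j → ∃ λ x → x ∉ D × c x ≡ j)
some-class-inside-or-all-meet {t = t} D c = case all? meets? of λ where
    (yes all-meet) → inj₂ all-meet
    (no ¬all-meet) → let j , ¬meets = ¬∀⟶∃¬ t _ meets? ¬all-meet in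
      inj₁ (j , λ x cx≡j → decidable-stable (x ∈? D) (λ x∉D → ¬meets (x , x∉D , cx≡j)))
  where
  meets? : ∀ j → Dec (∃ λ x → x ∉ D × c x ≡ j)
  meets? j = any? (λ x → ¬? (x ∈? D) ×-dec (c x ≟ j))

module _ {n : ℕ} (G : Graph n) where

  InN-sym : ∀ {x y} → InN G x y → InN G y x
  InN-sym {x} {y} = trans (Graph.sym G y x)

  InN-irrefl : ∀ {x} → ¬ InN G x x
  InN-irrefl {x} xx with trans (sym xx) (irrefl G x)
  ... | ()

  InN⇒InNc : ∀ {x z} → InN G x z → InNc G x z
  InN⇒InNc xz rewrite xz = ∨-zeroʳ _

  InNc⇒≡⊎InN : ∀ {x z} → InNc G x z → z ≡ x ⊎ InN G x z
  InNc⇒≡⊎InN {x} {z} xz with z ≟ x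
  ... | yes z≡x = inj₁ z≡x
  ... | no _ = inj₂ xz

  twin-adj : ∀ {x y z} → Twin G x y → InN G x z → z ≡ y ⊎ InN G y z
  twin-adj (inj₁ same-closed) xz = InNc⇒≡⊎InN (to (same-closed _) (InN⇒InNc xz))
  twin-adj (inj₂ same-open) xz = inj₂ (to (same-open _) xz)

  reachable-closed : (P : Fin n → Set) → (∀ {y z} → P y → InN G y z → P z) →
    ∀ {x y} → P x → Reachable G x y → P y
  reachable-closed P closed Px here = Px
  reachable-closed P closed Px (step x⇝y yz) = closed (reachable-closed P closed Px x⇝y) yz

  module _ (D : Subset n) (sd : SuperDominating G D) where

    PrivateTo : Fin n → Fin n → Set
    PrivateTo v u = ∀ {w} → InN G v w → w ∉ D → w ≡ u

    private-dominator : ∀ {u} → u ∉ D → ∃ λ v → v ∈ D × InN G v u × PrivateTo v u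
    private-dominator {u} u∉D with sd u u∉D
    ... | v , v∈D , only-u =
      v , v∈D , proj₁ (from (only-u u) refl) , λ vw w∉D → to (only-u _) (vw , w∉D)

    twins-outside-coincide : ∀ {x y} → x ∉ D → y ∉ D → Twin G x y → x ≡ y
    twins-outside-coincide x∉D y∉D x~y with private-dominator x∉D
    ... | v , v∈D , vx , v-private with twin-adj x~y (InN-sym vx)
    ...   | inj₁ v≡y = contradiction v≡y (x∈p∧y∉p⇒x≢y v∈D y∉D)
    ...   | inj₂ yv = sym (v-private (InN-sym yv) y∉D)

    ∣∁D∣<t : ∀ {t} (c : Fin n → Fin t) (twin : ∀ {x y} → c x ≡ c y → Twin G x y) →
      ∀ j → (∀ x → c x ≡ j → x ∈ D) → ∣ ∁ D ∣ < t
    ∣∁D∣<t {suc t} c twin j class-j⊆D = s≤s (∈-injective⇒∣p∣≤ (∁ D) (λ x∈∁D → punchOut (j≢c x∈∁D))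
      λ x∈∁D y∈∁D e → twins-outside-coincide (x∈∁p⇒x∉p x∈∁D) (x∈∁p⇒x∉p y∈∁D)
                        (twin (punchOut-injective (j≢c x∈∁D) (j≢c y∈∁D) e)))
      where
      j≢c : ∀ {x} → x ∈ ∁ D → j ≢ c x
      j≢c x∈∁D j≡cx = x∈∁p⇒x∉p x∈∁D (class-j⊆D _ (sym j≡cx))

    module TwinClassBounds {t : ℕ} (c : Fin n → Fin t)
                           (twin : ∀ {x y} → c x ≡ c y → Twin G x y) where

      ∣∁D∣≤t : ∣ ∁ D ∣ ≤ t
      ∣∁D∣≤t = ∈-injective⇒∣p∣≤ (∁ D) (λ {x} _ → c x)
        λ x∈∁D y∈∁D cx≡cy →
          twins-outside-coincide (x∈∁p⇒x∉p x∈∁D) (x∈∁p⇒x∉p y∈∁D) (twin cx≡cy)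

      n∸t≤∣D∣ : n ∸ t ≤ ∣ D ∣
      n∸t≤∣D∣ = m∸n≤o⇒m∸o≤n n ∣ D ∣ t (subst (_≤ t) (∣∁p∣≡n∸∣p∣ D) ∣∁D∣≤t)

      class-inside⇒n∸t<∣D∣ : Surjective _≡_ _≡_ c →
        ∀ j → (∀ x → c x ≡ j → x ∈ D) → n ∸ t < ∣ D ∣
      class-inside⇒n∸t<∣D∣ surjective j class-j⊆D =
        m∸n<o⇒m∸o<n n ∣ D ∣ t {{>-nonZero (0<∣p∣ D-nonempty)}}
          (subst (_< t) (∣∁p∣≡n∸∣p∣ D) (∣∁D∣<t c twin j class-j⊆D))
        where
        D-nonempty : proj₁ (surjective j) ∈ D
        D-nonempty = class-j⊆D _ (proj₂ (surjective j) refl)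

      module _ (meets : ∀ j → ∃ λ x → x ∉ D × c x ≡ j) where

        -- r is a twin, chosen outside D, of a private dominator of u.
        private-dominator-outside : ∀ {u} → u ∉ D →
          ∃ λ r → r ∉ D × PrivateTo r u × (u ≡ r ⊎ InN G r u)
        private-dominator-outside u∉D with private-dominator u∉D
        ... | v , v∈D , vu , v-private with meets (c v)
        ...   | r , r∉D , cr≡cv = r , r∉D , r-private , twin-adj (twin (sym cr≡cv)) vu
          where
          r-private : PrivateTo r _
          r-private rw w∉D with twin-adj (twin cr≡cv) rw
          ... | inj₁ w≡v = contradiction (sym w≡v) (x∈p∧y∉p⇒x≢y v∈D w∉D)
          ... | inj₂ vw = v-private vw w∉D

        mutually-private-pair : ∀ {u} → u ∉ D → ∃₂ λ a b → PrivateTo a b × PrivateTo b a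
        mutually-private-pair {u} u∉D with private-dominator-outside u∉D
        ... | _ , _ , u-private , inj₁ refl = u , u , u-private , u-private
        ... | r , r∉D , r-private , inj₂ ru with private-dominator-outside r∉D
        ...   | _ , _ , r-private′ , inj₁ refl =
          ⊥-elim (InN-irrefl (subst (InN G r) (r-private′ ru u∉D) ru))
        ...   | r′ , r′∉D , r′-private , inj₂ r′r =
          u , r , subst (λ s → PrivateTo s r) (r-private (InN-sym r′r) r′∉D) r′-private , r-private

        neighbour-class : ∀ {a b z} → PrivateTo a b → InN G a z → c z ≡ c a ⊎ c z ≡ c b
        neighbour-class {a} {b} {z} a-private az with meets (c z)
        ... | q , q∉D , cq≡cz with twin-adj (twin (sym cq≡cz)) (InN-sym az)
        ...   | inj₁ a≡q = inj₁ (trans (sym cq≡cz) (cong c (sym a≡q)))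
        ...   | inj₂ qa = inj₂ (trans (sym cq≡cz) (cong c (a-private (InN-sym qa) q∉D)))

        two-classes-closed : ∀ {a b} → PrivateTo a b → PrivateTo b a →
          ∀ {y z} → c y ≡ c a ⊎ c y ≡ c b → InN G y z → c z ≡ c a ⊎ c z ≡ c b
        two-classes-closed a-private b-private (inj₁ cy≡ca) yz with twin-adj (twin cy≡ca) yz
        ... | inj₁ z≡a = inj₁ (cong c z≡a)
        ... | inj₂ az = neighbour-class a-private az
        two-classes-closed a-private b-private (inj₂ cy≡cb) yz with twin-adj (twin cy≡cb) yz
        ... | inj₁ z≡b = inj₂ (cong c z≡b)
        ... | inj₂ bz = swap (neighbour-class b-private bz)

        -- The class j only serves to provide a vertex outside D.
        all-meet⇒t≤2 : Connected G → Surjective _≡_ _≡_ c → Fin t → t ≤ 2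
        all-meet⇒t≤2 connected surjective j
          with mutually-private-pair (proj₁ (proj₂ (meets j)))
        ... | a , b , a-private , b-private = covered-by-two⇒≤2 (c a) (c b) λ k →
          let x , cx≡k = surjective k in
          subst (λ k → k ≡ c a ⊎ k ≡ c b) (cx≡k refl)
            (reachable-closed (λ z → c z ≡ c a ⊎ c z ≡ c b)
              (two-classes-closed a-private b-private) (inj₁ refl) (connected a x))

theorem10 : ∀ (n : ℕ) (G : Graph n) (t k : ℕ) →
    HasTwinClasses G t → IsSuperDominationNumber G k →
    (n ∸ t ≤ k) × (Connected G → 3 ≤ t → n ∸ t + 1 ≤ k)
theorem10 n G t k (c , c-surjective , c-twin) ((D , sd , refl) , _) = n∸t≤∣D∣ , improved
  where
  twin : ∀ {x y} → c x ≡ c y → Twin G x y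
  twin = to (c-twin _ _)
  open TwinClassBounds G D sd c twin
  improved : Connected G → 3 ≤ t → n ∸ t + 1 ≤ ∣ D ∣
  improved connected 3≤t with some-class-inside-or-all-meet D c
  ... | inj₁ (j , class-j⊆D) =
    subst (_≤ ∣ D ∣) (+-comm 1 (n ∸ t)) (class-inside⇒n∸t<∣D∣ c-surjective j class-j⊆D)
  ... | inj₂ meets =
    contradiction 3≤t (≤⇒≯ (all-meet⇒t≤2 meets connected c-surjective (fromℕ< 3≤t)))
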